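{- Let $k$ be a field of characteristic not $2,3$ containing a primitive cube root of unity $\zeta$, and let $(a,b,c)\in k^3$ with $\Delta(a,b,c)\ne0$. Then $C_{abc}\simeq C_{a,\zeta b,c}$ over $k$.
   Context: Let $Q(a,b,c)=a^2+a(b-c)+(b-c)^2-3ac$, and put $q_3=Q(a,b,c)$, $q_4=Q(c,b,a)$, $t_3=Q(a,\zeta b,c)Q(a,\zeta^2 b,c)$, $t_4=Q(c,\zeta b,a)Q(c,\zeta^2b,a)$; these lie in $\mathbb{Z}[a,b,c]$. Define in $\mathbb{Z}[a,b,c][x]$: $H_1=b(a-c)q_4x^2-q_4x-1$, $\lambda_1=4act_3$, and $G_1=b(a-c)^2(a^2-4ac-b^2+c^2)q_4^2x^3-(a-c)q_4(a^4-4a^3b-8a^3c+3a^2b^2+18a^2bc+18a^2c^2+2ab^3-9ab^2c-12abc^2-8ac^3-2b^4-b^3c+2bc^3+c^4)x^2-q_4(2a^3-3a^2b-9a^2c+9abc+6ac^2+b^3-c^3)x-a(a^2-2ab-4ac+b^2+7bc+c^2)$. There is a sextic $f_{abc}(x)\in\mathbb{Z}[a,b,c][x]$ with $q_4^2f_{abc}=G_1^2+\lambda_1H_1^3$, with discriminant $\Delta(a,b,c)=2^{12}a^3b^9c^{14}(a-c)^{12}q_3^3t_3^3q_4^4t_4^4$. When $\Delta(a,b,c)\neq0$, $C_{abc}$ is the smooth genus 2 curve $y^2=f_{abc}(x)$. -}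

module Defs where

open import Level using (_⊔_)
open import Algebra.Bundles using (CommutativeRing)
open import Data.Nat using (ℕ; zero; suc; _∸_)
open import Data.List using (List; []; _∷_; map)
open import Data.List.Relation.Unary.All using (All)
open import Data.Vec using (Vec; lookup)
open import Data.Fin using (Fin; toℕ)
open import Data.Product using (Σ; _×_; ∃)
open import Relation.Nullary using (¬_)

IsField : ∀ {c ℓ} → CommutativeRing c ℓ → Set (c ⊔ ℓ)
IsField R = ¬ (1# ≈ 0#) × (∀ x → ¬ (x ≈ 0#) → ∃ λ y → x * y ≈ 1#)
  where open CommutativeRing R

module Curves {r ℓ} (R : CommutativeRing r ℓ) where
  open CommutativeRing R public

  lit : ℕ → Carrier
  lit zero = 0#
  lit (suc n) = 1# + lit n

  pow : Carrier → ℕ → Carrier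
  pow x zero = 1#
  pow x (suc n) = x * pow x n

  -- Polynomials in x over R as coefficient lists (constant term first).
  Poly : Set r
  Poly = List Carrier

  _+ₚ_ : Poly → Poly → Poly
  [] +ₚ q = q
  (p ∷ ps) +ₚ [] = p ∷ ps
  (p ∷ ps) +ₚ (q ∷ qs) = (p + q) ∷ (ps +ₚ qs)

  _*ₚ_ : Poly → Poly → Poly
  [] *ₚ q = []
  (p ∷ ps) *ₚ q = map (p *_) q +ₚ (0# ∷ (ps *ₚ q))

  negₚ : Poly → Poly
  negₚ = map (-_)

  cst : Carrier → Poly
  cst x = x ∷ []

  powₚ : Poly → ℕ → Poly
  powₚ p zero = cst 1#
  powₚ p (suc n) = p *ₚ powₚ p n

  -- equality of polynomials (coefficientwise, trailing zeros irrelevant)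
  _≈ₚ_ : Poly → Poly → Set (r ⊔ ℓ)
  p ≈ₚ q = All (_≈ 0#) (p +ₚ negₚ q)

  fromVec : ∀ {n} → Vec Carrier n → Poly
  fromVec Data.Vec.[] = []
  fromVec (x Data.Vec.∷ xs) = x ∷ fromVec xs

  Q : Carrier → Carrier → Carrier → Carrier
  Q a b c = a * a + a * (b - c) + (b - c) * (b - c) - lit 3 * a * c

  module _ (ζ a b c : Carrier) where
    q₃ q₄ t₃ t₄ : Carrier
    q₃ = Q a b c
    q₄ = Q c b a
    t₃ = Q a (ζ * b) c * Q a (ζ * ζ * b) c
    t₄ = Q c (ζ * b) a * Q c (ζ * ζ * b) a

    Δ : Carrier
    Δ = pow (lit 2) 12 * pow a 3 * pow b 9 * pow c 14 * pow (a - c) 12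
        * pow q₃ 3 * pow t₃ 3 * pow q₄ 4 * pow t₄ 4

    H₁ : Poly
    H₁ = (- 1#) ∷ (- q₄) ∷ (b * (a - c) * q₄) ∷ []

    λ₁ : Carrier
    λ₁ = lit 4 * a * c * t₃

    G₁ : Poly
    G₁ = g0 ∷ g1 ∷ g2 ∷ g3 ∷ []
      where
      g3 = b * pow (a - c) 2 * (pow a 2 - lit 4 * a * c - pow b 2 + pow c 2) * pow q₄ 2
      g2 = - ((a - c) * q₄ *
             (pow a 4 - lit 4 * pow a 3 * b - lit 8 * pow a 3 * c + lit 3 * pow a 2 * pow b 2
              + lit 18 * pow a 2 * b * c + lit 18 * pow a 2 * pow c 2 + lit 2 * a * pow b 3
              - lit 9 * a * pow b 2 * c - lit 12 * a * b * pow c 2 - lit 8 * a * pow c 3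
              - lit 2 * pow b 4 - pow b 3 * c + lit 2 * b * pow c 3 + pow c 4))
      g1 = - (q₄ * (lit 2 * pow a 3 - lit 3 * pow a 2 * b - lit 9 * pow a 2 * c + lit 9 * a * b * c
                    + lit 6 * a * pow c 2 + pow b 3 - pow c 3))
      g0 = - (a * (pow a 2 - lit 2 * a * b - lit 4 * a * c + pow b 2 + lit 7 * b * c + pow c 2))

    IsSexticOf : Vec Carrier 7 → Set (r ⊔ ℓ)
    IsSexticOf f = (cst (pow q₄ 2) *ₚ fromVec f) ≈ₚ (powₚ G₁ 2 +ₚ (cst λ₁ *ₚ powₚ H₁ 3))

  -- Isomorphism over R of the genus 2 curves y² = f(x) and y² = g(x) (f, g of degree ≤ 6):
  -- given by (x , y) ↦ ((αx+β)/(γx+δ) , e y/(γx+δ)³) with αδ-βγ ≠ 0, e ≠ 0, i.e.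
  -- g(x) = e² (γx+δ)⁶ f((αx+β)/(γx+δ)) as polynomials.
  Transform : Vec Carrier 7 → (α β γ δ : Carrier) → Poly
  Transform f α β γ δ = go 0 (fromVec f)
    where
    go : ℕ → Poly → Poly
    go i [] = []
    go i (fi ∷ fs) = (cst fi *ₚ (powₚ (β ∷ α ∷ []) i *ₚ powₚ (δ ∷ γ ∷ []) (6 ∸ i))) +ₚ go (suc i) fs

  CurveIso : Vec Carrier 7 → Vec Carrier 7 → Set (r ⊔ ℓ)
  CurveIso f g = Σ Carrier λ α → Σ Carrier λ β → Σ Carrier λ γ → Σ Carrier λ δ → Σ Carrier λ e →
    ¬ (α * δ - β * γ ≈ 0#) × ¬ (e ≈ 0#) ×
    (fromVec g ≈ₚ (cst (e * e) *ₚ Transform f α β γ δ))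

module Submission where

open import Defs
open import Algebra.Bundles using (CommutativeRing)
open import Data.Bool using (Bool; true; T; _∧_)
open import Data.Fin using (Fin; #_; _↑ʳ_; toℕ) renaming (zero to fzero; suc to fsuc)
open import Data.List as List using (List; []; _∷_)
open import Data.List.Relation.Unary.All using ([]; _∷_)
open import Data.Nat as ℕ using (ℕ; zero; suc; _∸_; compare; less; equal; greater)
open import Data.Nat.Properties using (_≟_)
open import Data.Product using (_×_; _,_; proj₁; proj₂)
open import Data.Unit using (tt)
open import Data.Vec using (Vec; []; _∷_; lookup; map; _++_)
open import Data.Vec.Properties using (lookup-map)
open import Data.Vec.Relation.Binary.Pointwise.Inductive as Pointwise using (Pointwise; []; _∷_)
open import Relation.Binary.PropositionalEquality as ≡ using (_≡_)
open import Relation.Nullary using (¬_)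
open import Relation.Nullary.Decidable using (yes; ⌊_⌋)

-- The isomorphism is (x , y) ↦ (x / (γx + 1) , y / (γx + 1)³) with γ = (1 − ζ) b (a − c).
-- As ζ ≠ 1 is a cube root of unity in a field, ζ² + ζ + 1 = 0; hence t₃, a norm from ℤ[ζ],
-- lies in ℤ[a,b,c], and since Δ ≠ 0 forces q₄ ≠ 0 the relation q₄² f = G₁² + λ₁ H₁³
-- determines f as an explicit sextic F(a,b,c), and likewise g = F(a,ζb,c). What remains,
-- (γx + 1)⁶ F(a,b,c)(x / (γx + 1)) = F(a,ζb,c)(x), is an identity in ℤ[a,b,c,ζ]/(ζ² + ζ + 1),
-- checked by a reflexive normaliser that reduces powers of ζ.

module Normaliser {r ℓ} (R : CommutativeRing r ℓ) where
  open Curves R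
  open import Relation.Binary.Reasoning.Setoid setoid
  open import Algebra.Properties.CommutativeSemigroup +-commutativeSemigroup
    using () renaming (interchange to +-interchange)
  open import Algebra.Properties.CommutativeSemigroup *-commutativeSemigroup
    using () renaming (interchange to *-interchange)
  open import Algebra.Properties.Ring ring using (-‿distribˡ-*; -‿distribʳ-*)
  open import Algebra.Properties.AbelianGroup +-abelianGroup using (⁻¹-∙-comm)
  open import Algebra.Properties.Group +-group
    using (⁻¹-involutive; ε⁻¹≈ε; x∙y⁻¹≈ε⇒x≈y)

  lit-+ : ∀ m n → lit (m ℕ.+ n) ≈ lit m + lit n
  lit-+ zero    n = sym (+-identityˡ (lit n))
  lit-+ (suc m) n = trans (+-congˡ (lit-+ m n)) (sym (+-assoc 1# (lit m) (lit n)))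

  lit-* : ∀ m n → lit (m ℕ.* n) ≈ lit m * lit n
  lit-* zero    n = sym (zeroˡ (lit n))
  lit-* (suc m) n = begin
    lit (n ℕ.+ m ℕ.* n)         ≈⟨ lit-+ n (m ℕ.* n) ⟩
    lit n + lit (m ℕ.* n)       ≈⟨ +-cong (sym (*-identityˡ (lit n))) (lit-* m n) ⟩
    1# * lit n + lit m * lit n  ≈⟨ sym (distribʳ (lit n) 1# (lit m)) ⟩
    (1# + lit m) * lit n        ∎

  pow-+ : ∀ x m n → pow x (m ℕ.+ n) ≈ pow x m * pow x n
  pow-+ x zero    n = sym (*-identityˡ (pow x n))
  pow-+ x (suc m) n = trans (*-congˡ (pow-+ x m n)) (sym (*-assoc x (pow x m) (pow x n)))

  pow-cong : ∀ {x y} k → x ≈ y → pow x k ≈ pow y k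
  pow-cong zero    x≈y = refl
  pow-cong (suc k) x≈y = *-cong x≈y (pow-cong k x≈y)

  Coefficient : Set
  Coefficient = ℕ × ℕ

  ⟦_⟧ᶜ : Coefficient → Carrier
  ⟦ p , n ⟧ᶜ = lit p - lit n

  1ᶜ-sound : ⟦ 1 , 0 ⟧ᶜ ≈ 1#
  1ᶜ-sound = trans (+-cong (+-identityʳ 1#) ε⁻¹≈ε) (+-identityʳ 1#)

  infixl 6 _+ᶜ_
  infixl 7 _*ᶜ_
  infix  8 -ᶜ_

  _+ᶜ_ _*ᶜ_ : Coefficient → Coefficient → Coefficient
  (p , n) +ᶜ (p′ , n′) = (p ℕ.+ p′ , n ℕ.+ n′)
  (p , n) *ᶜ (p′ , n′) = (p ℕ.* p′ ℕ.+ n ℕ.* n′ , p ℕ.* n′ ℕ.+ n ℕ.* p′)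

  -ᶜ_ : Coefficient → Coefficient
  -ᶜ (p , n) = (n , p)

  +ᶜ-sound : ∀ x y → ⟦ x +ᶜ y ⟧ᶜ ≈ ⟦ x ⟧ᶜ + ⟦ y ⟧ᶜ
  +ᶜ-sound (p , n) (p′ , n′) = begin
    lit (p ℕ.+ p′) - lit (n ℕ.+ n′)          ≈⟨ +-cong (lit-+ p p′) (-‿cong (lit-+ n n′)) ⟩
    (lit p + lit p′) - (lit n + lit n′)      ≈⟨ +-congˡ (sym (⁻¹-∙-comm (lit n) (lit n′))) ⟩
    (lit p + lit p′) + (- lit n + - lit n′)  ≈⟨ +-interchange _ _ _ _ ⟩
    (lit p - lit n) + (lit p′ - lit n′)      ∎

  -ᶜ-sound : ∀ x → ⟦ -ᶜ x ⟧ᶜ ≈ - ⟦ x ⟧ᶜ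
  -ᶜ-sound (p , n) = begin
    lit n - lit p      ≈⟨ +-congʳ (sym (⁻¹-involutive (lit n))) ⟩
    - - lit n - lit p  ≈⟨ +-comm _ _ ⟩
    - lit p + - - lit n ≈⟨ ⁻¹-∙-comm (lit p) (- lit n) ⟩
    - (lit p - lit n)  ∎

  difference-* : ∀ p n p′ n′ → (p - n) * (p′ - n′) ≈ (p * p′ + n * n′) - (p * n′ + n * p′)
  difference-* p n p′ n′ = begin
    (p - n) * (p′ - n′)
      ≈⟨ distribʳ (p′ - n′) p (- n) ⟩
    p * (p′ - n′) + - n * (p′ - n′)
      ≈⟨ +-cong (distribˡ p p′ (- n′)) (distribˡ (- n) p′ (- n′)) ⟩
    (p * p′ + p * - n′) + (- n * p′ + - n * - n′)
      ≈⟨ +-cong (+-congˡ (sym (-‿distribʳ-* p n′))) (+-cong (sym (-‿distribˡ-* n p′)) neg*neg) ⟩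
    (p * p′ - p * n′) + (- (n * p′) + n * n′)
      ≈⟨ +-congˡ (+-comm _ _) ⟩
    (p * p′ - p * n′) + (n * n′ - n * p′)
      ≈⟨ +-interchange _ _ _ _ ⟩
    (p * p′ + n * n′) + (- (p * n′) + - (n * p′))
      ≈⟨ +-congˡ (⁻¹-∙-comm (p * n′) (n * p′)) ⟩
    (p * p′ + n * n′) - (p * n′ + n * p′) ∎
    where
    neg*neg : - n * - n′ ≈ n * n′
    neg*neg = begin
      - n * - n′     ≈⟨ sym (-‿distribˡ-* n (- n′)) ⟩
      - (n * - n′)   ≈⟨ -‿cong (sym (-‿distribʳ-* n n′)) ⟩
      - - (n * n′)   ≈⟨ ⁻¹-involutive _ ⟩
      n * n′         ∎

  *ᶜ-sound : ∀ x y → ⟦ x *ᶜ y ⟧ᶜ ≈ ⟦ x ⟧ᶜ * ⟦ y ⟧ᶜ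
  *ᶜ-sound (p , n) (p′ , n′) = begin
    lit (p ℕ.* p′ ℕ.+ n ℕ.* n′) - lit (p ℕ.* n′ ℕ.+ n ℕ.* p′)
      ≈⟨ +-cong (trans (lit-+ (p ℕ.* p′) (n ℕ.* n′)) (+-cong (lit-* p p′) (lit-* n n′)))
                (-‿cong (trans (lit-+ (p ℕ.* n′) (n ℕ.* p′)) (+-cong (lit-* p n′) (lit-* n p′)))) ⟩
    (lit p * lit p′ + lit n * lit n′) - (lit p * lit n′ + lit n * lit p′)
      ≈⟨ sym (difference-* (lit p) (lit n) (lit p′) (lit n′)) ⟩
    (lit p - lit n) * (lit p′ - lit n′) ∎

  Monomial : ℕ → Set
  Monomial = Vec ℕ

  ⟦_⟧ᵐ : ∀ {n} → Monomial n → Vec Carrier n → Carrier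
  ⟦ [] ⟧ᵐ      []      = 1#
  ⟦ k ∷ m ⟧ᵐ (x ∷ ρ) = pow x k * ⟦ m ⟧ᵐ ρ

  _*ᵐ_ : ∀ {n} → Monomial n → Monomial n → Monomial n
  []      *ᵐ []        = []
  (i ∷ m) *ᵐ (j ∷ m′) = (i ℕ.+ j) ∷ (m *ᵐ m′)

  *ᵐ-sound : ∀ {n} (m m′ : Monomial n) ρ → ⟦ m *ᵐ m′ ⟧ᵐ ρ ≈ ⟦ m ⟧ᵐ ρ * ⟦ m′ ⟧ᵐ ρ
  *ᵐ-sound []      []        []      = sym (*-identityˡ 1#)
  *ᵐ-sound (i ∷ m) (j ∷ m′) (x ∷ ρ) =
    trans (*-cong (pow-+ x i j) (*ᵐ-sound m m′ ρ)) (*-interchange _ _ _ _)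

  1ᵐ : ∀ {n} → Monomial n
  1ᵐ {zero}  = []
  1ᵐ {suc n} = 0 ∷ 1ᵐ

  1ᵐ-sound : ∀ {n} (ρ : Vec Carrier n) → ⟦ 1ᵐ ⟧ᵐ ρ ≈ 1#
  1ᵐ-sound []      = refl
  1ᵐ-sound (x ∷ ρ) = trans (*-identityˡ _) (1ᵐ-sound ρ)

  varᵐ : ∀ {n} → Fin n → Monomial n
  varᵐ fzero    = 1 ∷ 1ᵐ
  varᵐ (fsuc i) = 0 ∷ varᵐ i

  varᵐ-sound : ∀ {n} (i : Fin n) ρ → ⟦ varᵐ i ⟧ᵐ ρ ≈ lookup ρ i
  varᵐ-sound fzero    (x ∷ ρ) = trans (*-cong (*-identityʳ x) (1ᵐ-sound ρ)) (*-identityʳ x)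
  varᵐ-sound (fsuc i) (x ∷ ρ) = trans (*-identityˡ _) (varᵐ-sound i ρ)

  -- Only the `equal` verdict matters for soundness; the order just makes normal forms canonical.
  data Comparison {n} (m m′ : Monomial n) : Set where
    less greater : Comparison m m′
    equal : m ≡ m′ → Comparison m m′

  compareᵐ : ∀ {n} (m m′ : Monomial n) → Comparison m m′
  compareᵐ []      []        = equal ≡.refl
  compareᵐ (i ∷ m) (j ∷ m′) with compare i j
  ... | less _ _    = less
  ... | greater _ _ = greater
  ... | equal _ with compareᵐ m m′
  ...   | less      = less
  ...   | greater   = greater
  ...   | equal m≡m′ = equal (≡.cong (i ∷_) m≡m′)

  -- Sums of terms, kept sorted by compareᵐ so that equal monomials are merged.
  NormalForm : ℕ → Set
  NormalForm n = List (Coefficient × Monomial n)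

  ⟦_⟧ⁿ : ∀ {n} → NormalForm n → Vec Carrier n → Carrier
  ⟦ [] ⟧ⁿ          ρ = 0#
  ⟦ (k , m) ∷ p ⟧ⁿ ρ = ⟦ k ⟧ᶜ * ⟦ m ⟧ᵐ ρ + ⟦ p ⟧ⁿ ρ

  mutual
    infixl 6 _+ⁿ_
    _+ⁿ_ : ∀ {n} → NormalForm n → NormalForm n → NormalForm n
    []      +ⁿ q = q
    (t ∷ p) +ⁿ q = insert t p q

    insert : ∀ {n} → Coefficient × Monomial n → NormalForm n → NormalForm n → NormalForm n
    insert t p [] = t ∷ p
    insert (k , m) p ((k′ , m′) ∷ q) = merge k m p k′ m′ q (compareᵐ m m′)

    merge : ∀ {n} → Coefficient → (m : Monomial n) → NormalForm n →
            Coefficient → (m′ : Monomial n) → NormalForm n → Comparison m m′ → NormalForm n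
    merge k m p k′ m′ q less      = (k , m) ∷ (p +ⁿ ((k′ , m′) ∷ q))
    merge k m p k′ m′ q greater   = (k′ , m′) ∷ insert (k , m) p q
    merge k m p k′ m′ q (equal _) = (k +ᶜ k′ , m) ∷ (p +ⁿ q)

  mutual
    +ⁿ-sound : ∀ {n} (p q : NormalForm n) ρ → ⟦ p +ⁿ q ⟧ⁿ ρ ≈ ⟦ p ⟧ⁿ ρ + ⟦ q ⟧ⁿ ρ
    +ⁿ-sound []      q ρ = sym (+-identityˡ _)
    +ⁿ-sound (t ∷ p) q ρ = insert-sound t p q ρ

    insert-sound : ∀ {n} t (p q : NormalForm n) ρ → ⟦ insert t p q ⟧ⁿ ρ ≈ ⟦ t ∷ p ⟧ⁿ ρ + ⟦ q ⟧ⁿ ρ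
    insert-sound t p [] ρ = sym (+-identityʳ _)
    insert-sound (k , m) p ((k′ , m′) ∷ q) ρ = merge-sound k m p k′ m′ q (compareᵐ m m′) ρ

    merge-sound : ∀ {n} k (m : Monomial n) p k′ m′ q (c : Comparison m m′) ρ →
      ⟦ merge k m p k′ m′ q c ⟧ⁿ ρ ≈ ⟦ (k , m) ∷ p ⟧ⁿ ρ + ⟦ (k′ , m′) ∷ q ⟧ⁿ ρ
    merge-sound k m p k′ m′ q less ρ =
      trans (+-congˡ (+ⁿ-sound p ((k′ , m′) ∷ q) ρ)) (sym (+-assoc _ _ _))
    merge-sound k m p k′ m′ q greater ρ = begin
      ⟦ k′ ⟧ᶜ * ⟦ m′ ⟧ᵐ ρ + ⟦ insert (k , m) p q ⟧ⁿ ρ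
        ≈⟨ +-congˡ (insert-sound (k , m) p q ρ) ⟩
      ⟦ k′ ⟧ᶜ * ⟦ m′ ⟧ᵐ ρ + (⟦ (k , m) ∷ p ⟧ⁿ ρ + ⟦ q ⟧ⁿ ρ)
        ≈⟨ sym (+-assoc _ _ _) ⟩
      (⟦ k′ ⟧ᶜ * ⟦ m′ ⟧ᵐ ρ + ⟦ (k , m) ∷ p ⟧ⁿ ρ) + ⟦ q ⟧ⁿ ρ
        ≈⟨ +-congʳ (+-comm _ _) ⟩
      (⟦ (k , m) ∷ p ⟧ⁿ ρ + ⟦ k′ ⟧ᶜ * ⟦ m′ ⟧ᵐ ρ) + ⟦ q ⟧ⁿ ρ
        ≈⟨ +-assoc _ _ _ ⟩
      ⟦ (k , m) ∷ p ⟧ⁿ ρ + ⟦ (k′ , m′) ∷ q ⟧ⁿ ρ ∎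
    merge-sound k m p k′ m′ q (equal ≡.refl) ρ = begin
      ⟦ k +ᶜ k′ ⟧ᶜ * ⟦ m ⟧ᵐ ρ + ⟦ p +ⁿ q ⟧ⁿ ρ
        ≈⟨ +-cong (trans (*-congʳ (+ᶜ-sound k k′)) (distribʳ _ _ _)) (+ⁿ-sound p q ρ) ⟩
      (⟦ k ⟧ᶜ * ⟦ m ⟧ᵐ ρ + ⟦ k′ ⟧ᶜ * ⟦ m ⟧ᵐ ρ) + (⟦ p ⟧ⁿ ρ + ⟦ q ⟧ⁿ ρ)
        ≈⟨ +-interchange _ _ _ _ ⟩
      ⟦ (k , m) ∷ p ⟧ⁿ ρ + ⟦ (k′ , m) ∷ q ⟧ⁿ ρ ∎

  -ⁿ_ : ∀ {n} → NormalForm n → NormalForm n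
  -ⁿ []            = []
  -ⁿ ((k , m) ∷ p) = (-ᶜ k , m) ∷ (-ⁿ p)

  -ⁿ-sound : ∀ {n} (p : NormalForm n) ρ → ⟦ -ⁿ p ⟧ⁿ ρ ≈ - ⟦ p ⟧ⁿ ρ
  -ⁿ-sound []            ρ = sym ε⁻¹≈ε
  -ⁿ-sound ((k , m) ∷ p) ρ = begin
    ⟦ -ᶜ k ⟧ᶜ * ⟦ m ⟧ᵐ ρ + ⟦ -ⁿ p ⟧ⁿ ρ
      ≈⟨ +-cong (trans (*-congʳ (-ᶜ-sound k)) (sym (-‿distribˡ-* _ _))) (-ⁿ-sound p ρ) ⟩
    - (⟦ k ⟧ᶜ * ⟦ m ⟧ᵐ ρ) + - ⟦ p ⟧ⁿ ρ
      ≈⟨ ⁻¹-∙-comm _ _ ⟩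
    - ⟦ (k , m) ∷ p ⟧ⁿ ρ ∎

  scale : ∀ {n} → Coefficient × Monomial n → NormalForm n → NormalForm n
  scale t             []              = []
  scale (k , m) ((k′ , m′) ∷ q) = (k *ᶜ k′ , m *ᵐ m′) ∷ scale (k , m) q

  scale-sound : ∀ {n} k (m : Monomial n) q ρ → ⟦ scale (k , m) q ⟧ⁿ ρ ≈ (⟦ k ⟧ᶜ * ⟦ m ⟧ᵐ ρ) * ⟦ q ⟧ⁿ ρ
  scale-sound k m []              ρ = sym (zeroʳ _)
  scale-sound k m ((k′ , m′) ∷ q) ρ = begin
    ⟦ k *ᶜ k′ ⟧ᶜ * ⟦ m *ᵐ m′ ⟧ᵐ ρ + ⟦ scale (k , m) q ⟧ⁿ ρ
      ≈⟨ +-cong (*-cong (*ᶜ-sound k k′) (*ᵐ-sound m m′ ρ)) (scale-sound k m q ρ) ⟩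
    (⟦ k ⟧ᶜ * ⟦ k′ ⟧ᶜ) * (⟦ m ⟧ᵐ ρ * ⟦ m′ ⟧ᵐ ρ) + (⟦ k ⟧ᶜ * ⟦ m ⟧ᵐ ρ) * ⟦ q ⟧ⁿ ρ
      ≈⟨ +-congʳ (*-interchange _ _ _ _) ⟩
    (⟦ k ⟧ᶜ * ⟦ m ⟧ᵐ ρ) * (⟦ k′ ⟧ᶜ * ⟦ m′ ⟧ᵐ ρ) + (⟦ k ⟧ᶜ * ⟦ m ⟧ᵐ ρ) * ⟦ q ⟧ⁿ ρ
      ≈⟨ sym (distribˡ _ _ _) ⟩
    (⟦ k ⟧ᶜ * ⟦ m ⟧ᵐ ρ) * ⟦ (k′ , m′) ∷ q ⟧ⁿ ρ ∎

  infixl 7 _*ⁿ_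
  _*ⁿ_ : ∀ {n} → NormalForm n → NormalForm n → NormalForm n
  []      *ⁿ q = []
  (t ∷ p) *ⁿ q = scale t q +ⁿ (p *ⁿ q)

  *ⁿ-sound : ∀ {n} (p q : NormalForm n) ρ → ⟦ p *ⁿ q ⟧ⁿ ρ ≈ ⟦ p ⟧ⁿ ρ * ⟦ q ⟧ⁿ ρ
  *ⁿ-sound []            q ρ = sym (zeroˡ _)
  *ⁿ-sound ((k , m) ∷ p) q ρ = begin
    ⟦ scale (k , m) q +ⁿ (p *ⁿ q) ⟧ⁿ ρ
      ≈⟨ +ⁿ-sound (scale (k , m) q) (p *ⁿ q) ρ ⟩
    ⟦ scale (k , m) q ⟧ⁿ ρ + ⟦ p *ⁿ q ⟧ⁿ ρ
      ≈⟨ +-cong (scale-sound k m q ρ) (*ⁿ-sound p q ρ) ⟩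
    (⟦ k ⟧ᶜ * ⟦ m ⟧ᵐ ρ) * ⟦ q ⟧ⁿ ρ + ⟦ p ⟧ⁿ ρ * ⟦ q ⟧ⁿ ρ
      ≈⟨ sym (distribʳ _ _ _) ⟩
    ⟦ (k , m) ∷ p ⟧ⁿ ρ * ⟦ q ⟧ⁿ ρ ∎

  litⁿ : ∀ {n} → ℕ → NormalForm n
  litⁿ k = ((k , 0) , 1ᵐ) ∷ []

  litⁿ-sound : ∀ {n} k (ρ : Vec Carrier n) → ⟦ litⁿ k ⟧ⁿ ρ ≈ lit k
  litⁿ-sound k ρ = begin
    (lit k - 0#) * ⟦ 1ᵐ ⟧ᵐ ρ + 0#  ≈⟨ +-identityʳ _ ⟩
    (lit k - 0#) * ⟦ 1ᵐ ⟧ᵐ ρ       ≈⟨ *-cong (trans (+-congˡ ε⁻¹≈ε) (+-identityʳ _)) (1ᵐ-sound ρ) ⟩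
    lit k * 1#                    ≈⟨ *-identityʳ _ ⟩
    lit k                         ∎

  1ⁿ-sound : ∀ {n} (ρ : Vec Carrier n) → ⟦ litⁿ 1 ⟧ⁿ ρ ≈ 1#
  1ⁿ-sound ρ = trans (litⁿ-sound 1 ρ) (+-identityʳ 1#)

  powⁿ : ∀ {n} → NormalForm n → ℕ → NormalForm n
  powⁿ p zero    = litⁿ 1
  powⁿ p (suc k) = p *ⁿ powⁿ p k

  powⁿ-sound : ∀ {n} (p : NormalForm n) k ρ → ⟦ powⁿ p k ⟧ⁿ ρ ≈ pow (⟦ p ⟧ⁿ ρ) k
  powⁿ-sound p zero    ρ = 1ⁿ-sound ρ
  powⁿ-sound p (suc k) ρ = trans (*ⁿ-sound p (powⁿ p k) ρ) (*-congˡ (powⁿ-sound p k ρ))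

  infixl 6 _⊕_ _⊖_
  infixl 7 _⊗_
  infix  8 ⊝_
  data Expr (n : ℕ) : Set where
    var : Fin n → Expr n
    zer one : Expr n
    litE : ℕ → Expr n
    _⊕_ _⊗_ _⊖_ : Expr n → Expr n → Expr n
    ⊝_ : Expr n → Expr n
    powE : Expr n → ℕ → Expr n

  eval : ∀ {n} → Vec Carrier n → Expr n → Carrier
  eval ρ (var i)    = lookup ρ i
  eval ρ zer        = 0#
  eval ρ one        = 1#
  eval ρ (litE k)   = lit k
  eval ρ (x ⊕ y)    = eval ρ x + eval ρ y
  eval ρ (x ⊗ y)    = eval ρ x * eval ρ y
  eval ρ (x ⊖ y)    = eval ρ x - eval ρ y
  eval ρ (⊝ x)      = - eval ρ x
  eval ρ (powE x k) = pow (eval ρ x) k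

  eval-cong : ∀ {n} {ρ ρ′ : Vec Carrier n} → Pointwise _≈_ ρ ρ′ → ∀ e → eval ρ e ≈ eval ρ′ e
  eval-cong ρ≈ρ′ (var i)    = Pointwise.lookup ρ≈ρ′ i
  eval-cong ρ≈ρ′ zer        = refl
  eval-cong ρ≈ρ′ one        = refl
  eval-cong ρ≈ρ′ (litE k)   = refl
  eval-cong ρ≈ρ′ (x ⊕ y)    = +-cong (eval-cong ρ≈ρ′ x) (eval-cong ρ≈ρ′ y)
  eval-cong ρ≈ρ′ (x ⊗ y)    = *-cong (eval-cong ρ≈ρ′ x) (eval-cong ρ≈ρ′ y)
  eval-cong ρ≈ρ′ (x ⊖ y)    = +-cong (eval-cong ρ≈ρ′ x) (-‿cong (eval-cong ρ≈ρ′ y))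
  eval-cong ρ≈ρ′ (⊝ x)      = -‿cong (eval-cong ρ≈ρ′ x)
  eval-cong ρ≈ρ′ (powE x k) = pow-cong k (eval-cong ρ≈ρ′ x)

  infixl 9 _[_]
  _[_] : ∀ {m n} → Expr m → Vec (Expr n) m → Expr n
  var i    [ σ ] = lookup σ i
  zer      [ σ ] = zer
  one      [ σ ] = one
  litE k   [ σ ] = litE k
  (x ⊕ y)  [ σ ] = x [ σ ] ⊕ y [ σ ]
  (x ⊗ y)  [ σ ] = x [ σ ] ⊗ y [ σ ]
  (x ⊖ y)  [ σ ] = x [ σ ] ⊖ y [ σ ]
  (⊝ x)    [ σ ] = ⊝ x [ σ ]
  powE x k [ σ ] = powE (x [ σ ]) k

  eval-[] : ∀ {m n} (ρ : Vec Carrier n) (σ : Vec (Expr n) m) e → eval ρ (e [ σ ]) ≡ eval (map (eval ρ) σ) e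
  eval-[] ρ σ (var i)    = ≡.sym (lookup-map i (eval ρ) σ)
  eval-[] ρ σ zer        = ≡.refl
  eval-[] ρ σ one        = ≡.refl
  eval-[] ρ σ (litE k)   = ≡.refl
  eval-[] ρ σ (x ⊕ y)    = ≡.cong₂ _+_ (eval-[] ρ σ x) (eval-[] ρ σ y)
  eval-[] ρ σ (x ⊗ y)    = ≡.cong₂ _*_ (eval-[] ρ σ x) (eval-[] ρ σ y)
  eval-[] ρ σ (x ⊖ y)    = ≡.cong₂ _-_ (eval-[] ρ σ x) (eval-[] ρ σ y)
  eval-[] ρ σ (⊝ x)      = ≡.cong -_ (eval-[] ρ σ x)
  eval-[] ρ σ (powE x k) = ≡.cong (λ y → pow y k) (eval-[] ρ σ x)

  norm : ∀ {n} → Expr n → NormalForm n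
  norm (var i)    = ((1 , 0) , varᵐ i) ∷ []
  norm zer        = []
  norm one        = litⁿ 1
  norm (litE k)   = litⁿ k
  norm (x ⊕ y)    = norm x +ⁿ norm y
  norm (x ⊗ y)    = norm x *ⁿ norm y
  norm (x ⊖ y)    = norm x +ⁿ (-ⁿ norm y)
  norm (⊝ x)      = -ⁿ norm x
  norm (powE x k) = powⁿ (norm x) k

  norm-sound : ∀ {n} (e : Expr n) ρ → ⟦ norm e ⟧ⁿ ρ ≈ eval ρ e
  norm-sound (var i)    ρ = trans (+-identityʳ _) (trans (*-cong 1ᶜ-sound (varᵐ-sound i ρ)) (*-identityˡ _))
  norm-sound zer        ρ = refl
  norm-sound one        ρ = 1ⁿ-sound ρ
  norm-sound (litE k)   ρ = litⁿ-sound k ρ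
  norm-sound (x ⊕ y)    ρ = trans (+ⁿ-sound (norm x) (norm y) ρ) (+-cong (norm-sound x ρ) (norm-sound y ρ))
  norm-sound (x ⊗ y)    ρ = trans (*ⁿ-sound (norm x) (norm y) ρ) (*-cong (norm-sound x ρ) (norm-sound y ρ))
  norm-sound (x ⊖ y)    ρ = trans (+ⁿ-sound (norm x) (-ⁿ norm y) ρ)
                                  (+-cong (norm-sound x ρ) (trans (-ⁿ-sound (norm y) ρ) (-‿cong (norm-sound y ρ))))
  norm-sound (⊝ x)      ρ = trans (-ⁿ-sound (norm x) ρ) (-‿cong (norm-sound x ρ))
  norm-sound (powE x k) ρ = trans (powⁿ-sound (norm x) k ρ) (pow-cong k (norm-sound x ρ))

  isZero : ∀ {n} → NormalForm n → Bool
  isZero []                  = true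
  isZero (((p , n) , _) ∷ q) = ⌊ p ≟ n ⌋ ∧ isZero q

  isZero-sound : ∀ {n} (p : NormalForm n) ρ → T (isZero p) → ⟦ p ⟧ⁿ ρ ≈ 0#
  isZero-sound []                  ρ _ = refl
  isZero-sound (((p , n) , m) ∷ q) ρ h with p ≟ n
  ... | yes ≡.refl = begin
    (lit p - lit p) * ⟦ m ⟧ᵐ ρ + ⟦ q ⟧ⁿ ρ  ≈⟨ +-cong (*-congʳ (-‿inverseʳ (lit p))) (isZero-sound q ρ h) ⟩
    0# * ⟦ m ⟧ᵐ ρ + 0#                    ≈⟨ +-identityʳ _ ⟩
    0# * ⟦ m ⟧ᵐ ρ                         ≈⟨ zeroˡ _ ⟩
    0#                                    ∎

  prove : ∀ {n} (ρ : Vec Carrier n) e₁ e₂ → T (isZero (norm (e₁ ⊖ e₂))) → eval ρ e₁ ≈ eval ρ e₂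
  prove ρ e₁ e₂ h =
    x∙y⁻¹≈ε⇒x≈y _ _ (trans (sym (norm-sound (e₁ ⊖ e₂) ρ)) (isZero-sound (norm (e₁ ⊖ e₂)) ρ h))

  cube-1-factorisation : ∀ x → pow x 3 - 1# ≈ (x - 1#) * (x * x + x + 1#)
  cube-1-factorisation x = prove (x ∷ []) (powE X 3 ⊖ one) ((X ⊖ one) ⊗ (X ⊗ X ⊕ X ⊕ one)) tt
    where
    X : Expr 1
    X = var (# 0)

  -- Identities in R[ζ]/(ζ² + ζ + 1), with ζ the first variable: normal forms are reduced
  -- to degree at most 1 in ζ using ζ³ = 1 and ζ² = − 1 − ζ.
  module CubeRootOfUnity {ζ : Carrier} (ζ-root : ζ * ζ + ζ + 1# ≈ 0#) where

    ζ³≈1 : pow ζ 3 ≈ 1#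
    ζ³≈1 = x∙y⁻¹≈ε⇒x≈y _ _ (begin
      pow ζ 3 - 1#                  ≈⟨ cube-1-factorisation ζ ⟩
      (ζ - 1#) * (ζ * ζ + ζ + 1#)  ≈⟨ *-congˡ ζ-root ⟩
      (ζ - 1#) * 0#                 ≈⟨ zeroʳ _ ⟩
      0#                            ∎)

    reduceTerm : ∀ {n} → Coefficient → ℕ → Monomial n → NormalForm (suc n)
    reduceTerm k 0                   m = (k , 0 ∷ m) ∷ []
    reduceTerm k 1                   m = (k , 1 ∷ m) ∷ []
    reduceTerm k 2                   m = (-ᶜ k , 0 ∷ m) ∷ (-ᶜ k , 1 ∷ m) ∷ []
    reduceTerm k (suc (suc (suc e))) m = reduceTerm k e m

    reduceTerm-sound : ∀ {n} k e (m : Monomial n) ρ →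
      ⟦ reduceTerm k e m ⟧ⁿ (ζ ∷ ρ) ≈ ⟦ k ⟧ᶜ * (pow ζ e * ⟦ m ⟧ᵐ ρ)
    reduceTerm-sound k 0 m ρ = +-identityʳ _
    reduceTerm-sound k 1 m ρ = +-identityʳ _
    reduceTerm-sound k 2 m ρ = begin
      ⟦ -ᶜ k ⟧ᶜ * (1# * M) + (⟦ -ᶜ k ⟧ᶜ * ((ζ * 1#) * M) + 0#)
        ≈⟨ +-cong (*-congʳ (-ᶜ-sound k)) (+-congʳ (*-congʳ (-ᶜ-sound k))) ⟩
      - K * (1# * M) + (- K * ((ζ * 1#) * M) + 0#)
        ≈⟨ sym (+-identityʳ _) ⟩
      - K * (1# * M) + (- K * ((ζ * 1#) * M) + 0#) + 0#
        ≈⟨ +-congˡ (sym (trans (*-congˡ ζ-root) (zeroʳ _))) ⟩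
      - K * (1# * M) + (- K * ((ζ * 1#) * M) + 0#) + K * M * (ζ * ζ + ζ + 1#)
        ≈⟨ prove (K ∷ ζ ∷ M ∷ [])
             (⊝ Kₑ ⊗ (one ⊗ Mₑ) ⊕ (⊝ Kₑ ⊗ ((Zₑ ⊗ one) ⊗ Mₑ) ⊕ zer) ⊕ Kₑ ⊗ Mₑ ⊗ (Zₑ ⊗ Zₑ ⊕ Zₑ ⊕ one))
             (Kₑ ⊗ (powE Zₑ 2 ⊗ Mₑ)) tt ⟩
      K * (pow ζ 2 * M) ∎
      where
      K M : Carrier
      K = ⟦ k ⟧ᶜ
      M = ⟦ m ⟧ᵐ ρ
      Kₑ Zₑ Mₑ : Expr 3
      Kₑ = var (# 0)
      Zₑ = var (# 1)
      Mₑ = var (# 2)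
    reduceTerm-sound k (suc (suc (suc e))) m ρ = begin
      ⟦ reduceTerm k e m ⟧ⁿ (ζ ∷ ρ)            ≈⟨ reduceTerm-sound k e m ρ ⟩
      ⟦ k ⟧ᶜ * (pow ζ e * ⟦ m ⟧ᵐ ρ)            ≈⟨ *-congˡ (*-congʳ ζᵉ≈ζ³⁺ᵉ) ⟩
      ⟦ k ⟧ᶜ * (pow ζ (3 ℕ.+ e) * ⟦ m ⟧ᵐ ρ)    ∎
      where
      ζᵉ≈ζ³⁺ᵉ : pow ζ e ≈ pow ζ (3 ℕ.+ e)
      ζᵉ≈ζ³⁺ᵉ = sym (trans (pow-+ ζ 3 e) (trans (*-congʳ ζ³≈1) (*-identityˡ _)))

    reduce : ∀ {n} → NormalForm (suc n) → NormalForm (suc n)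
    reduce []                  = []
    reduce ((k , e ∷ m) ∷ p) = reduceTerm k e m +ⁿ reduce p

    reduce-sound : ∀ {n} (p : NormalForm (suc n)) ρ → ⟦ reduce p ⟧ⁿ (ζ ∷ ρ) ≈ ⟦ p ⟧ⁿ (ζ ∷ ρ)
    reduce-sound []                ρ = refl
    reduce-sound ((k , e ∷ m) ∷ p) ρ =
      trans (+ⁿ-sound (reduceTerm k e m) (reduce p) (ζ ∷ ρ))
            (+-cong (reduceTerm-sound k e m ρ) (reduce-sound p ρ))

    prove-cyclotomic : ∀ {n} (ρ : Vec Carrier n) e₁ e₂ →
      T (isZero (reduce (norm (e₁ ⊖ e₂)))) → eval (ζ ∷ ρ) e₁ ≈ eval (ζ ∷ ρ) e₂
    prove-cyclotomic ρ e₁ e₂ h = x∙y⁻¹≈ε⇒x≈y _ _ (begin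
      eval (ζ ∷ ρ) (e₁ ⊖ e₂)            ≈⟨ sym (norm-sound (e₁ ⊖ e₂) (ζ ∷ ρ)) ⟩
      ⟦ norm (e₁ ⊖ e₂) ⟧ⁿ (ζ ∷ ρ)         ≈⟨ sym (reduce-sound (norm (e₁ ⊖ e₂)) ρ) ⟩
      ⟦ reduce (norm (e₁ ⊖ e₂)) ⟧ⁿ (ζ ∷ ρ) ≈⟨ isZero-sound (reduce (norm (e₁ ⊖ e₂))) (ζ ∷ ρ) h ⟩
      0#                                ∎)

module CurveSyntax {r ℓ} (R : CommutativeRing r ℓ) where
  open Normaliser R

  -- Polynomials in x with coefficients in Expr n, mirroring Curves.Poly: evaluating them
  -- coefficientwise reproduces the operations of Defs definitionally.
  infixl 6 _+ᴾ_
  infixl 7 _*ᴾ_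

  _+ᴾ_ : ∀ {n} → List (Expr n) → List (Expr n) → List (Expr n)
  []       +ᴾ q        = q
  (p ∷ ps) +ᴾ []       = p ∷ ps
  (p ∷ ps) +ᴾ (q ∷ qs) = (p ⊕ q) ∷ (ps +ᴾ qs)

  _*ᴾ_ : ∀ {n} → List (Expr n) → List (Expr n) → List (Expr n)
  []       *ᴾ q = []
  (p ∷ ps) *ᴾ q = List.map (p ⊗_) q +ᴾ (zer ∷ (ps *ᴾ q))

  -ᴾ_ : ∀ {n} → List (Expr n) → List (Expr n)
  -ᴾ_ = List.map ⊝_

  cstᴾ : ∀ {n} → Expr n → List (Expr n)
  cstᴾ x = x ∷ []

  powᴾ : ∀ {n} → List (Expr n) → ℕ → List (Expr n)
  powᴾ p zero    = cstᴾ one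
  powᴾ p (suc k) = p *ᴾ powᴾ p k

  coefficient : ∀ {n} → List (Expr n) → ℕ → Expr n
  coefficient []       _       = zer
  coefficient (x ∷ xs) zero    = x
  coefficient (x ∷ xs) (suc i) = coefficient xs i

  Qᴱ : ∀ {n} → Expr n → Expr n → Expr n → Expr n
  Qᴱ a b c = a ⊗ a ⊕ a ⊗ (b ⊖ c) ⊕ (b ⊖ c) ⊗ (b ⊖ c) ⊖ litE 3 ⊗ a ⊗ c

  module _ {n} (ζ a b c : Expr n) where
    q₄ᴱ t₃ᴱ λ₁ᴱ : Expr n
    q₄ᴱ = Qᴱ c b a
    t₃ᴱ = Qᴱ a (ζ ⊗ b) c ⊗ Qᴱ a (ζ ⊗ ζ ⊗ b) c
    λ₁ᴱ = litE 4 ⊗ a ⊗ c ⊗ t₃ᴱ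

    H₁ᴱ : List (Expr n)
    H₁ᴱ = (⊝ one) ∷ (⊝ q₄ᴱ) ∷ (b ⊗ (a ⊖ c) ⊗ q₄ᴱ) ∷ []

    G₁ᴱ : List (Expr n)
    G₁ᴱ = g₀ ∷ g₁ ∷ g₂ ∷ g₃ ∷ []
      where
      g₀ g₁ g₂ g₃ : Expr n
      g₃ = b ⊗ powE (a ⊖ c) 2 ⊗ (powE a 2 ⊖ litE 4 ⊗ a ⊗ c ⊖ powE b 2 ⊕ powE c 2) ⊗ powE q₄ᴱ 2
      g₂ = ⊝ ((a ⊖ c) ⊗ q₄ᴱ ⊗
             (powE a 4 ⊖ litE 4 ⊗ powE a 3 ⊗ b ⊖ litE 8 ⊗ powE a 3 ⊗ c ⊕ litE 3 ⊗ powE a 2 ⊗ powE b 2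
              ⊕ litE 18 ⊗ powE a 2 ⊗ b ⊗ c ⊕ litE 18 ⊗ powE a 2 ⊗ powE c 2 ⊕ litE 2 ⊗ a ⊗ powE b 3
              ⊖ litE 9 ⊗ a ⊗ powE b 2 ⊗ c ⊖ litE 12 ⊗ a ⊗ b ⊗ powE c 2 ⊖ litE 8 ⊗ a ⊗ powE c 3
              ⊖ litE 2 ⊗ powE b 4 ⊖ powE b 3 ⊗ c ⊕ litE 2 ⊗ b ⊗ powE c 3 ⊕ powE c 4))
      g₁ = ⊝ (q₄ᴱ ⊗ (litE 2 ⊗ powE a 3 ⊖ litE 3 ⊗ powE a 2 ⊗ b ⊖ litE 9 ⊗ powE a 2 ⊗ c ⊕ litE 9 ⊗ a ⊗ b ⊗ c
                    ⊕ litE 6 ⊗ a ⊗ powE c 2 ⊕ powE b 3 ⊖ powE c 3))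
      g₀ = ⊝ (a ⊗ (powE a 2 ⊖ litE 2 ⊗ a ⊗ b ⊖ litE 4 ⊗ a ⊗ c ⊕ powE b 2 ⊕ litE 7 ⊗ b ⊗ c ⊕ powE c 2))

    sexticDefectᴱ : List (Expr n) → List (Expr n)
    sexticDefectᴱ f = (cstᴾ (powE q₄ᴱ 2) *ᴾ f) +ᴾ -ᴾ (powᴾ G₁ᴱ 2 +ᴾ (cstᴾ λ₁ᴱ *ᴾ powᴾ H₁ᴱ 3))

  Transformᴱ : ∀ {n} → List (Expr n) → (α β γ δ : Expr n) → List (Expr n)
  Transformᴱ {n} f α β γ δ = go 0 f
    where
    go : ℕ → List (Expr n) → List (Expr n)
    go i []       = []
    go i (fᵢ ∷ f) = (cstᴾ fᵢ *ᴾ (powᴾ (β ∷ α ∷ []) i *ᴾ powᴾ (δ ∷ γ ∷ []) (6 ∸ i))) +ᴾ go (suc i) f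

  -- The coefficients of f_{abc} = (G₁² + λ₁ H₁³) / q₄² ∈ ℤ[a,b,c].
  explicitSexticᴱ : ∀ {n} → Expr n → Expr n → Expr n → Vec (Expr n) 7
  explicitSexticᴱ {n} A B C = F₀ ∷ F₁ ∷ F₂ ∷ F₃ ∷ F₄ ∷ F₅ ∷ F₆ ∷ []
    where
    F₀ F₁ F₂ F₃ F₄ F₅ F₆ : Expr n
    F₀ =
      powE A 2 ⊖ litE 4 ⊗ A ⊗ C
    F₁ =
      litE 4 ⊗ powE A 4 ⊖ litE 6 ⊗ powE A 3 ⊗ B ⊖ litE 30 ⊗ powE A 3 ⊗ C ⊕ litE 30 ⊗ powE A 2 ⊗ B ⊗ C
      ⊕ litE 60 ⊗ powE A 2 ⊗ powE C 2 ⊕ litE 2 ⊗ A ⊗ powE B 3 ⊖ litE 24 ⊗ A ⊗ B ⊗ powE C 2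
      ⊖ litE 14 ⊗ A ⊗ powE C 3
    F₂ =
      litE 6 ⊗ powE A 6 ⊖ litE 20 ⊗ powE A 5 ⊗ B ⊖ litE 66 ⊗ powE A 5 ⊗ C
      ⊕ litE 15 ⊗ powE A 4 ⊗ powE B 2 ⊕ litE 170 ⊗ powE A 4 ⊗ B ⊗ C ⊕ litE 253 ⊗ powE A 4 ⊗ powE C 2
      ⊕ litE 8 ⊗ powE A 3 ⊗ powE B 3 ⊖ litE 90 ⊗ powE A 3 ⊗ powE B 2 ⊗ C
      ⊖ litE 450 ⊗ powE A 3 ⊗ B ⊗ powE C 2 ⊖ litE 380 ⊗ powE A 3 ⊗ powE C 3
      ⊖ litE 10 ⊗ powE A 2 ⊗ powE B 4 ⊖ litE 24 ⊗ powE A 2 ⊗ powE B 3 ⊗ C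
      ⊕ litE 135 ⊗ powE A 2 ⊗ powE B 2 ⊗ powE C 2 ⊕ litE 370 ⊗ powE A 2 ⊗ B ⊗ powE C 3
      ⊕ litE 168 ⊗ powE A 2 ⊗ powE C 4 ⊕ litE 10 ⊗ A ⊗ powE B 4 ⊗ C ⊕ litE 2 ⊗ A ⊗ powE B 3 ⊗ powE C 2
      ⊖ litE 60 ⊗ A ⊗ powE B 2 ⊗ powE C 3 ⊖ litE 70 ⊗ A ⊗ B ⊗ powE C 4 ⊖ litE 26 ⊗ A ⊗ powE C 5
      ⊕ powE B 6 ⊖ litE 2 ⊗ powE B 3 ⊗ powE C 3 ⊕ powE C 6
    F₃ =
      litE 4 ⊗ powE A 8 ⊖ litE 24 ⊗ powE A 7 ⊗ B ⊖ litE 58 ⊗ powE A 7 ⊗ C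
      ⊕ litE 40 ⊗ powE A 6 ⊗ powE B 2 ⊕ litE 288 ⊗ powE A 6 ⊗ B ⊗ C ⊕ litE 326 ⊗ powE A 6 ⊗ powE C 2
      ⊖ litE 8 ⊗ powE A 5 ⊗ powE B 3 ⊖ litE 380 ⊗ powE A 5 ⊗ powE B 2 ⊗ C
      ⊖ litE 1276 ⊗ powE A 5 ⊗ B ⊗ powE C 2 ⊖ litE 886 ⊗ powE A 5 ⊗ powE C 3
      ⊖ litE 32 ⊗ powE A 4 ⊗ powE B 4 ⊕ litE 68 ⊗ powE A 4 ⊗ powE B 3 ⊗ C
      ⊕ litE 1240 ⊗ powE A 4 ⊗ powE B 2 ⊗ powE C 2 ⊕ litE 2532 ⊗ powE A 4 ⊗ B ⊗ powE C 3
      ⊕ litE 1186 ⊗ powE A 4 ⊗ powE C 4 ⊕ litE 20 ⊗ powE A 3 ⊗ powE B 5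
      ⊕ litE 128 ⊗ powE A 3 ⊗ powE B 4 ⊗ C ⊖ litE 184 ⊗ powE A 3 ⊗ powE B 3 ⊗ powE C 2
      ⊖ litE 1640 ⊗ powE A 3 ⊗ powE B 2 ⊗ powE C 3 ⊖ litE 2192 ⊗ powE A 3 ⊗ B ⊗ powE C 4
      ⊖ litE 734 ⊗ powE A 3 ⊗ powE C 5 ⊕ litE 4 ⊗ powE A 2 ⊗ powE B 6
      ⊖ litE 40 ⊗ powE A 2 ⊗ powE B 5 ⊗ C ⊖ litE 104 ⊗ powE A 2 ⊗ powE B 4 ⊗ powE C 2
      ⊕ litE 220 ⊗ powE A 2 ⊗ powE B 3 ⊗ powE C 3 ⊕ litE 880 ⊗ powE A 2 ⊗ powE B 2 ⊗ powE C 4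
      ⊕ litE 776 ⊗ powE A 2 ⊗ B ⊗ powE C 5 ⊕ litE 226 ⊗ powE A 2 ⊗ powE C 6 ⊖ litE 4 ⊗ A ⊗ powE B 7
      ⊖ litE 10 ⊗ A ⊗ powE B 6 ⊗ C ⊕ litE 20 ⊗ A ⊗ powE B 5 ⊗ powE C 2
      ⊕ litE 16 ⊗ A ⊗ powE B 4 ⊗ powE C 3 ⊖ litE 64 ⊗ A ⊗ powE B 3 ⊗ powE C 4
      ⊖ litE 140 ⊗ A ⊗ powE B 2 ⊗ powE C 5 ⊖ litE 108 ⊗ A ⊗ B ⊗ powE C 6 ⊖ litE 34 ⊗ A ⊗ powE C 7
      ⊕ litE 4 ⊗ powE B 7 ⊗ C ⊕ litE 2 ⊗ powE B 6 ⊗ powE C 2 ⊖ litE 8 ⊗ powE B 4 ⊗ powE C 4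
      ⊖ litE 4 ⊗ powE B 3 ⊗ powE C 5 ⊕ litE 4 ⊗ B ⊗ powE C 7 ⊕ litE 2 ⊗ powE C 8
    F₄ =
      powE A 10 ⊖ litE 12 ⊗ powE A 9 ⊗ B ⊖ litE 18 ⊗ powE A 9 ⊗ C ⊕ litE 36 ⊗ powE A 8 ⊗ powE B 2
      ⊕ litE 186 ⊗ powE A 8 ⊗ B ⊗ C ⊕ litE 133 ⊗ powE A 8 ⊗ powE C 2 ⊖ litE 32 ⊗ powE A 7 ⊗ powE B 3
      ⊖ litE 468 ⊗ powE A 7 ⊗ powE B 2 ⊗ C ⊖ litE 1152 ⊗ powE A 7 ⊗ B ⊗ powE C 2
      ⊖ litE 520 ⊗ powE A 7 ⊗ powE C 3 ⊖ litE 21 ⊗ powE A 6 ⊗ powE B 4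
      ⊕ litE 348 ⊗ powE A 6 ⊗ powE B 3 ⊗ C ⊕ litE 2346 ⊗ powE A 6 ⊗ powE B 2 ⊗ powE C 2
      ⊕ litE 3636 ⊗ powE A 6 ⊗ B ⊗ powE C 3 ⊕ litE 1162 ⊗ powE A 6 ⊗ powE C 4
      ⊕ litE 48 ⊗ powE A 5 ⊗ powE B 5 ⊕ litE 132 ⊗ powE A 5 ⊗ powE B 4 ⊗ C
      ⊖ litE 1394 ⊗ powE A 5 ⊗ powE B 3 ⊗ powE C 2 ⊖ litE 5712 ⊗ powE A 5 ⊗ powE B 2 ⊗ powE C 3
      ⊖ litE 6216 ⊗ powE A 5 ⊗ B ⊗ powE C 4 ⊖ litE 1516 ⊗ powE A 5 ⊗ powE C 5
      ⊖ litE 14 ⊗ powE A 4 ⊗ powE B 6 ⊖ litE 240 ⊗ powE A 4 ⊗ powE B 5 ⊗ C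
      ⊖ litE 234 ⊗ powE A 4 ⊗ powE B 4 ⊗ powE C 2 ⊕ litE 2578 ⊗ powE A 4 ⊗ powE B 3 ⊗ powE C 3
      ⊕ litE 7086 ⊗ powE A 4 ⊗ powE B 2 ⊗ powE C 4 ⊕ litE 5760 ⊗ powE A 4 ⊗ B ⊗ powE C 5
      ⊕ litE 1162 ⊗ powE A 4 ⊗ powE C 6 ⊖ litE 12 ⊗ powE A 3 ⊗ powE B 7
      ⊕ litE 30 ⊗ powE A 3 ⊗ powE B 6 ⊗ C ⊕ litE 348 ⊗ powE A 3 ⊗ powE B 5 ⊗ powE C 2
      ⊕ litE 48 ⊗ powE A 3 ⊗ powE B 4 ⊗ powE C 3 ⊖ litE 2336 ⊗ powE A 3 ⊗ powE B 3 ⊗ powE C 4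
      ⊖ litE 4452 ⊗ powE A 3 ⊗ powE B 2 ⊗ powE C 5 ⊖ litE 2880 ⊗ powE A 3 ⊗ B ⊗ powE C 6
      ⊖ litE 520 ⊗ powE A 3 ⊗ powE C 7 ⊕ litE 6 ⊗ powE A 2 ⊗ powE B 8
      ⊕ litE 42 ⊗ powE A 2 ⊗ powE B 7 ⊗ C ⊖ litE 17 ⊗ powE A 2 ⊗ powE B 6 ⊗ powE C 2
      ⊖ litE 180 ⊗ powE A 2 ⊗ powE B 5 ⊗ powE C 3 ⊕ litE 87 ⊗ powE A 2 ⊗ powE B 4 ⊗ powE C 4
      ⊕ litE 964 ⊗ powE A 2 ⊗ powE B 3 ⊗ powE C 5 ⊕ litE 1326 ⊗ powE A 2 ⊗ powE B 2 ⊗ powE C 6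
      ⊕ litE 780 ⊗ powE A 2 ⊗ B ⊗ powE C 7 ⊕ litE 133 ⊗ powE A 2 ⊗ powE C 8
      ⊖ litE 12 ⊗ A ⊗ powE B 8 ⊗ C ⊖ litE 36 ⊗ A ⊗ powE B 7 ⊗ powE C 2
      ⊕ litE 36 ⊗ A ⊗ powE B 5 ⊗ powE C 4 ⊖ litE 126 ⊗ A ⊗ powE B 3 ⊗ powE C 6
      ⊖ litE 168 ⊗ A ⊗ powE B 2 ⊗ powE C 7 ⊖ litE 108 ⊗ A ⊗ B ⊗ powE C 8 ⊖ litE 18 ⊗ A ⊗ powE C 9
      ⊕ litE 6 ⊗ powE B 8 ⊗ powE C 2 ⊕ litE 6 ⊗ powE B 7 ⊗ powE C 3 ⊕ powE B 6 ⊗ powE C 4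
      ⊖ litE 12 ⊗ powE B 5 ⊗ powE C 5 ⊖ litE 12 ⊗ powE B 4 ⊗ powE C 6 ⊖ litE 2 ⊗ powE B 3 ⊗ powE C 7
      ⊕ litE 6 ⊗ powE B 2 ⊗ powE C 8 ⊕ litE 6 ⊗ B ⊗ powE C 9 ⊕ powE C 10
    F₅ =
      ⊝ (litE 2 ⊗ powE A 11 ⊗ B) ⊕ litE 12 ⊗ powE A 10 ⊗ powE B 2 ⊕ litE 38 ⊗ powE A 10 ⊗ B ⊗ C
      ⊖ litE 22 ⊗ powE A 9 ⊗ powE B 3 ⊖ litE 198 ⊗ powE A 9 ⊗ powE B 2 ⊗ C
      ⊖ litE 302 ⊗ powE A 9 ⊗ B ⊗ powE C 2 ⊕ litE 4 ⊗ powE A 8 ⊗ powE B 4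
      ⊕ litE 312 ⊗ powE A 8 ⊗ powE B 3 ⊗ C ⊕ litE 1338 ⊗ powE A 8 ⊗ powE B 2 ⊗ powE C 2
      ⊕ litE 1306 ⊗ powE A 8 ⊗ B ⊗ powE C 3 ⊕ litE 30 ⊗ powE A 7 ⊗ powE B 5
      ⊖ litE 70 ⊗ powE A 7 ⊗ powE B 4 ⊗ C ⊖ litE 1764 ⊗ powE A 7 ⊗ powE B 3 ⊗ powE C 2
      ⊖ litE 4788 ⊗ powE A 7 ⊗ powE B 2 ⊗ powE C 3 ⊖ litE 3364 ⊗ powE A 7 ⊗ B ⊗ powE C 4
      ⊖ litE 28 ⊗ powE A 6 ⊗ powE B 6 ⊖ litE 234 ⊗ powE A 6 ⊗ powE B 5 ⊗ C
      ⊕ litE 424 ⊗ powE A 6 ⊗ powE B 4 ⊗ powE C 2 ⊕ litE 5108 ⊗ powE A 6 ⊗ powE B 3 ⊗ powE C 3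
      ⊕ litE 9852 ⊗ powE A 6 ⊗ powE B 2 ⊗ powE C 4 ⊕ litE 5356 ⊗ powE A 6 ⊗ B ⊗ powE C 5
      ⊖ litE 2 ⊗ powE A 5 ⊗ powE B 7 ⊕ litE 162 ⊗ powE A 5 ⊗ powE B 6 ⊗ C
      ⊕ litE 636 ⊗ powE A 5 ⊗ powE B 5 ⊗ powE C 2 ⊖ litE 1194 ⊗ powE A 5 ⊗ powE B 4 ⊗ powE C 3
      ⊖ litE 8184 ⊗ powE A 5 ⊗ powE B 3 ⊗ powE C 4 ⊖ litE 11976 ⊗ powE A 5 ⊗ powE B 2 ⊗ powE C 5
      ⊖ litE 5356 ⊗ powE A 5 ⊗ B ⊗ powE C 6 ⊕ litE 12 ⊗ powE A 4 ⊗ powE B 8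
      ⊕ litE 32 ⊗ powE A 4 ⊗ powE B 7 ⊗ C ⊖ litE 312 ⊗ powE A 4 ⊗ powE B 6 ⊗ powE C 2
      ⊖ litE 732 ⊗ powE A 4 ⊗ powE B 5 ⊗ powE C 3 ⊕ litE 1728 ⊗ powE A 4 ⊗ powE B 4 ⊗ powE C 4
      ⊕ litE 7428 ⊗ powE A 4 ⊗ powE B 3 ⊗ powE C 5 ⊕ litE 8640 ⊗ powE A 4 ⊗ powE B 2 ⊗ powE C 6
      ⊕ litE 3364 ⊗ powE A 4 ⊗ B ⊗ powE C 7 ⊖ litE 4 ⊗ powE A 3 ⊗ powE B 9
      ⊖ litE 54 ⊗ powE A 3 ⊗ powE B 8 ⊗ C ⊖ litE 86 ⊗ powE A 3 ⊗ powE B 7 ⊗ powE C 2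
      ⊕ litE 252 ⊗ powE A 3 ⊗ powE B 6 ⊗ powE C 3 ⊕ litE 366 ⊗ powE A 3 ⊗ powE B 5 ⊗ powE C 4
      ⊖ litE 1290 ⊗ powE A 3 ⊗ powE B 4 ⊗ powE C 5 ⊖ litE 3740 ⊗ powE A 3 ⊗ powE B 3 ⊗ powE C 6
      ⊖ litE 3660 ⊗ powE A 3 ⊗ powE B 2 ⊗ powE C 7 ⊖ litE 1306 ⊗ powE A 3 ⊗ B ⊗ powE C 8
      ⊕ litE 12 ⊗ powE A 2 ⊗ powE B 9 ⊗ C ⊕ litE 78 ⊗ powE A 2 ⊗ powE B 8 ⊗ powE C 2
      ⊕ litE 86 ⊗ powE A 2 ⊗ powE B 7 ⊗ powE C 3 ⊖ litE 84 ⊗ powE A 2 ⊗ powE B 6 ⊗ powE C 4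
      ⊖ litE 102 ⊗ powE A 2 ⊗ powE B 5 ⊗ powE C 5 ⊕ litE 440 ⊗ powE A 2 ⊗ powE B 4 ⊗ powE C 6
      ⊕ litE 972 ⊗ powE A 2 ⊗ powE B 3 ⊗ powE C 7 ⊕ litE 888 ⊗ powE A 2 ⊗ powE B 2 ⊗ powE C 8
      ⊕ litE 302 ⊗ powE A 2 ⊗ B ⊗ powE C 9 ⊖ litE 12 ⊗ A ⊗ powE B 9 ⊗ powE C 2
      ⊖ litE 42 ⊗ A ⊗ powE B 8 ⊗ powE C 3 ⊖ litE 32 ⊗ A ⊗ powE B 7 ⊗ powE C 4
      ⊕ litE 18 ⊗ A ⊗ powE B 6 ⊗ powE C 5 ⊕ litE 48 ⊗ A ⊗ powE B 5 ⊗ powE C 6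
      ⊖ litE 38 ⊗ A ⊗ powE B 4 ⊗ powE C 7 ⊖ litE 114 ⊗ A ⊗ powE B 3 ⊗ powE C 8
      ⊖ litE 114 ⊗ A ⊗ powE B 2 ⊗ powE C 9 ⊖ litE 38 ⊗ A ⊗ B ⊗ powE C 10
      ⊕ litE 4 ⊗ powE B 9 ⊗ powE C 3 ⊕ litE 6 ⊗ powE B 8 ⊗ powE C 4 ⊕ litE 2 ⊗ powE B 7 ⊗ powE C 5
      ⊖ litE 8 ⊗ powE B 6 ⊗ powE C 6 ⊖ litE 12 ⊗ powE B 5 ⊗ powE C 7 ⊖ litE 4 ⊗ powE B 4 ⊗ powE C 8
      ⊕ litE 4 ⊗ powE B 3 ⊗ powE C 9 ⊕ litE 6 ⊗ powE B 2 ⊗ powE C 10 ⊕ litE 2 ⊗ B ⊗ powE C 11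
    F₆ =
      powE A 12 ⊗ powE B 2 ⊖ litE 4 ⊗ powE A 11 ⊗ powE B 3 ⊖ litE 20 ⊗ powE A 11 ⊗ powE B 2 ⊗ C
      ⊕ litE 4 ⊗ powE A 10 ⊗ powE B 4 ⊕ litE 70 ⊗ powE A 10 ⊗ powE B 3 ⊗ C
      ⊕ litE 170 ⊗ powE A 10 ⊗ powE B 2 ⊗ powE C 2 ⊕ litE 4 ⊗ powE A 9 ⊗ powE B 5
      ⊖ litE 64 ⊗ powE A 9 ⊗ powE B 4 ⊗ C ⊖ litE 512 ⊗ powE A 9 ⊗ powE B 3 ⊗ powE C 2
      ⊖ litE 804 ⊗ powE A 9 ⊗ powE B 2 ⊗ powE C 3 ⊖ litE 10 ⊗ powE A 8 ⊗ powE B 6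
      ⊖ litE 38 ⊗ powE A 8 ⊗ powE B 5 ⊗ C ⊕ litE 417 ⊗ powE A 8 ⊗ powE B 4 ⊗ powE C 2
      ⊕ litE 2042 ⊗ powE A 8 ⊗ powE B 3 ⊗ powE C 3 ⊕ litE 2335 ⊗ powE A 8 ⊗ powE B 2 ⊗ powE C 4
      ⊕ litE 4 ⊗ powE A 7 ⊗ powE B 7 ⊕ litE 88 ⊗ powE A 7 ⊗ powE B 6 ⊗ C
      ⊕ litE 128 ⊗ powE A 7 ⊗ powE B 5 ⊗ powE C 2 ⊖ litE 1436 ⊗ powE A 7 ⊗ powE B 4 ⊗ powE C 3
      ⊖ litE 4880 ⊗ powE A 7 ⊗ powE B 3 ⊗ powE C 4 ⊖ litE 4360 ⊗ powE A 7 ⊗ powE B 2 ⊗ powE C 5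
      ⊕ litE 4 ⊗ powE A 6 ⊗ powE B 8 ⊖ litE 22 ⊗ powE A 6 ⊗ powE B 7 ⊗ C
      ⊖ litE 290 ⊗ powE A 6 ⊗ powE B 6 ⊗ powE C 2 ⊖ litE 172 ⊗ powE A 6 ⊗ powE B 5 ⊗ powE C 3
      ⊕ litE 2864 ⊗ powE A 6 ⊗ powE B 4 ⊗ powE C 4 ⊕ litE 7276 ⊗ powE A 6 ⊗ powE B 3 ⊗ powE C 5
      ⊕ litE 5356 ⊗ powE A 6 ⊗ powE B 2 ⊗ powE C 6 ⊖ litE 4 ⊗ powE A 5 ⊗ powE B 9
      ⊖ litE 32 ⊗ powE A 5 ⊗ powE B 8 ⊗ C ⊕ litE 36 ⊗ powE A 5 ⊗ powE B 7 ⊗ powE C 2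
      ⊕ litE 456 ⊗ powE A 5 ⊗ powE B 6 ⊗ powE C 3 ⊕ litE 24 ⊗ powE A 5 ⊗ powE B 5 ⊗ powE C 4
      ⊖ litE 3444 ⊗ powE A 5 ⊗ powE B 4 ⊗ powE C 5 ⊖ litE 6872 ⊗ powE A 5 ⊗ powE B 3 ⊗ powE C 6
      ⊖ litE 4360 ⊗ powE A 5 ⊗ powE B 2 ⊗ powE C 7 ⊕ powE A 4 ⊗ powE B 10
      ⊕ litE 22 ⊗ powE A 4 ⊗ powE B 9 ⊗ C ⊕ litE 89 ⊗ powE A 4 ⊗ powE B 8 ⊗ powE C 2
      ⊖ litE 6 ⊗ powE A 4 ⊗ powE B 7 ⊗ powE C 3 ⊖ litE 366 ⊗ powE A 4 ⊗ powE B 6 ⊗ powE C 4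
      ⊕ litE 168 ⊗ powE A 4 ⊗ powE B 5 ⊗ powE C 5 ⊕ litE 2510 ⊗ powE A 4 ⊗ powE B 4 ⊗ powE C 6
      ⊕ litE 4100 ⊗ powE A 4 ⊗ powE B 3 ⊗ powE C 7 ⊕ litE 2335 ⊗ powE A 4 ⊗ powE B 2 ⊗ powE C 8
      ⊖ litE 4 ⊗ powE A 3 ⊗ powE B 10 ⊗ C ⊖ litE 44 ⊗ powE A 3 ⊗ powE B 9 ⊗ powE C 2
      ⊖ litE 116 ⊗ powE A 3 ⊗ powE B 8 ⊗ powE C 3 ⊖ litE 36 ⊗ powE A 3 ⊗ powE B 7 ⊗ powE C 4
      ⊕ litE 156 ⊗ powE A 3 ⊗ powE B 6 ⊗ powE C 5 ⊖ litE 160 ⊗ powE A 3 ⊗ powE B 5 ⊗ powE C 6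
      ⊖ litE 1076 ⊗ powE A 3 ⊗ powE B 4 ⊗ powE C 7 ⊖ litE 1516 ⊗ powE A 3 ⊗ powE B 3 ⊗ powE C 8
      ⊖ litE 804 ⊗ powE A 3 ⊗ powE B 2 ⊗ powE C 9 ⊕ litE 6 ⊗ powE A 2 ⊗ powE B 10 ⊗ powE C 2
      ⊕ litE 40 ⊗ powE A 2 ⊗ powE B 9 ⊗ powE C 3 ⊕ litE 74 ⊗ powE A 2 ⊗ powE B 8 ⊗ powE C 4
      ⊕ litE 30 ⊗ powE A 2 ⊗ powE B 7 ⊗ powE C 5 ⊖ litE 50 ⊗ powE A 2 ⊗ powE B 6 ⊗ powE C 6
      ⊕ litE 44 ⊗ powE A 2 ⊗ powE B 5 ⊗ powE C 7 ⊕ litE 252 ⊗ powE A 2 ⊗ powE B 4 ⊗ powE C 8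
      ⊕ litE 334 ⊗ powE A 2 ⊗ powE B 3 ⊗ powE C 9 ⊕ litE 170 ⊗ powE A 2 ⊗ powE B 2 ⊗ powE C 10
      ⊖ litE 4 ⊗ A ⊗ powE B 10 ⊗ powE C 3 ⊖ litE 16 ⊗ A ⊗ powE B 9 ⊗ powE C 4
      ⊖ litE 20 ⊗ A ⊗ powE B 8 ⊗ powE C 5 ⊖ litE 4 ⊗ A ⊗ powE B 7 ⊗ powE C 6
      ⊕ litE 20 ⊗ A ⊗ powE B 6 ⊗ powE C 7 ⊕ litE 4 ⊗ A ⊗ powE B 5 ⊗ powE C 8
      ⊖ litE 28 ⊗ A ⊗ powE B 4 ⊗ powE C 9 ⊖ litE 40 ⊗ A ⊗ powE B 3 ⊗ powE C 10
      ⊖ litE 20 ⊗ A ⊗ powE B 2 ⊗ powE C 11 ⊕ powE B 10 ⊗ powE C 4 ⊕ litE 2 ⊗ powE B 9 ⊗ powE C 5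
      ⊕ powE B 8 ⊗ powE C 6 ⊖ litE 2 ⊗ powE B 7 ⊗ powE C 7 ⊖ litE 4 ⊗ powE B 6 ⊗ powE C 8
      ⊖ litE 2 ⊗ powE B 5 ⊗ powE C 9 ⊕ powE B 4 ⊗ powE C 10 ⊕ litE 2 ⊗ powE B 3 ⊗ powE C 11
      ⊕ powE B 2 ⊗ powE C 12

  ζₑ aₑ bₑ cₑ : ∀ {n} → Expr (4 ℕ.+ n)
  ζₑ = var (# 0)
  aₑ = var (# 1)
  bₑ = var (# 2)
  cₑ = var (# 3)

  fᴱ : ∀ {n} → List (Expr (11 ℕ.+ n))
  fᴱ = var (# 4) ∷ var (# 5) ∷ var (# 6) ∷ var (# 7) ∷ var (# 8) ∷ var (# 9) ∷ var (# 10) ∷ []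

  gᴱ : List (Expr 18)
  gᴱ = var (# 11) ∷ var (# 12) ∷ var (# 13) ∷ var (# 14) ∷ var (# 15) ∷ var (# 16) ∷ var (# 17) ∷ []

  γᴱ : ∀ {n} → Expr (4 ℕ.+ n)
  γᴱ = (one ⊖ ζₑ) ⊗ bₑ ⊗ (aₑ ⊖ cₑ)

  differenceᴱ : List (Expr 18)
  differenceᴱ = gᴱ +ᴾ -ᴾ (cstᴾ (one ⊗ one) *ᴾ Transformᴱ fᴱ one zer γᴱ one)

  explicitSexticsᴱ : Vec (Expr 4) 18
  explicitSexticsᴱ = ζₑ ∷ aₑ ∷ bₑ ∷ cₑ ∷ explicitSexticᴱ aₑ bₑ cₑ ++ explicitSexticᴱ aₑ (ζₑ ⊗ bₑ) cₑ

module Isomorphism {r ℓ} (R : CommutativeRing r ℓ) (isField : IsField R) where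
  open Curves R
  open Normaliser R
  open CurveSyntax R
  open import Relation.Binary.Reasoning.Setoid setoid
  open import Algebra.Properties.Group +-group using (x∙y⁻¹≈ε⇒x≈y; x≈y⇒x∙y⁻¹≈ε)

  1≉0 : ¬ 1# ≈ 0#
  1≉0 = proj₁ isField

  x≉0∧xy≈0⇒y≈0 : ∀ {x y} → ¬ x ≈ 0# → x * y ≈ 0# → y ≈ 0#
  x≉0∧xy≈0⇒y≈0 {x} {y} x≉0 xy≈0 with proj₂ isField x x≉0
  ... | x⁻¹ , xx⁻¹≈1 = begin
    y                ≈⟨ sym (*-identityˡ y) ⟩
    1# * y           ≈⟨ *-congʳ (sym xx⁻¹≈1) ⟩
    (x * x⁻¹) * y    ≈⟨ *-congʳ (*-comm x x⁻¹) ⟩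
    (x⁻¹ * x) * y    ≈⟨ *-assoc x⁻¹ x y ⟩
    x⁻¹ * (x * y)    ≈⟨ *-congˡ xy≈0 ⟩
    x⁻¹ * 0#         ≈⟨ zeroʳ x⁻¹ ⟩
    0#               ∎

  pow≉0 : ∀ {x} → ¬ x ≈ 0# → ∀ n → ¬ pow x n ≈ 0#
  pow≉0 x≉0 zero    = 1≉0
  pow≉0 x≉0 (suc n) xⁿ⁺¹≈0 = pow≉0 x≉0 n (x≉0∧xy≈0⇒y≈0 x≉0 xⁿ⁺¹≈0)

  pow≈0 : ∀ {x} n → x ≈ 0# → pow x (suc n) ≈ 0#
  pow≈0 n x≈0 = trans (*-congʳ x≈0) (zeroˡ _)

  primitive-cube-root : ∀ {ζ} → pow ζ 3 ≈ 1# → ¬ ζ ≈ 1# → ζ * ζ + ζ + 1# ≈ 0#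
  primitive-cube-root {ζ} ζ³≈1 ζ≉1 = x≉0∧xy≈0⇒y≈0 ζ-1≉0 (begin
    (ζ - 1#) * (ζ * ζ + ζ + 1#)  ≈⟨ sym (cube-1-factorisation ζ) ⟩
    pow ζ 3 - 1#                  ≈⟨ x≈y⇒x∙y⁻¹≈ε ζ³≈1 ⟩
    0#                            ∎)
    where
    ζ-1≉0 : ¬ ζ - 1# ≈ 0#
    ζ-1≉0 ζ-1≈0 = ζ≉1 (x∙y⁻¹≈ε⇒x≈y ζ 1# ζ-1≈0)

  det≉0 : ∀ γ → ¬ 1# * 1# - 0# * γ ≈ 0#
  det≉0 γ det≈0 = 1≉0 (trans (prove (γ ∷ []) one (one ⊗ one ⊖ zer ⊗ var (# 0)) tt) det≈0)

  module _ {ζ a b c : Carrier} (Δ≉0 : ¬ Δ ζ a b c ≈ 0#) where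

    Δ≉0⇒q₄≉0 : ¬ Q c b a ≈ 0#
    Δ≉0⇒q₄≉0 q₄≈0 = Δ≉0 (trans (*-congʳ (trans (*-congˡ (pow≈0 3 q₄≈0)) (zeroʳ _))) (zeroˡ _))

    Δ≉0⇒q₄[ζb]≉0 : ¬ Q c (ζ * b) a ≈ 0#
    Δ≉0⇒q₄[ζb]≉0 q₄≈0 = Δ≉0 (trans (*-congˡ (pow≈0 3 (trans (*-congʳ q₄≈0) (zeroˡ _)))) (zeroʳ _))

  module _ {ζ : Carrier} (ζ-root : ζ * ζ + ζ + 1# ≈ 0#) where
    open CubeRootOfUnity ζ-root

    sextic-determined : ∀ {a b c} → ¬ Q c b a ≈ 0# → (f : Vec Carrier 7) → IsSexticOf ζ a b c f →
      Pointwise _≈_ f (map (eval (ζ ∷ a ∷ b ∷ c ∷ [])) (explicitSexticᴱ aₑ bₑ cₑ))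
    sextic-determined {a} {b} {c} q₄≉0 f@(_ ∷ _ ∷ _ ∷ _ ∷ _ ∷ _ ∷ _ ∷ [])
      (h₀ ∷ h₁ ∷ h₂ ∷ h₃ ∷ h₄ ∷ h₅ ∷ h₆ ∷ []) =
      determined (# 0) tt h₀ ∷ determined (# 1) tt h₁ ∷ determined (# 2) tt h₂ ∷
      determined (# 3) tt h₃ ∷ determined (# 4) tt h₄ ∷ determined (# 5) tt h₅ ∷
      determined (# 6) tt h₆ ∷ []
      where
      ρ : Vec Carrier 10
      ρ = a ∷ b ∷ c ∷ f
      defect : ℕ → Expr 11
      defect = coefficient (sexticDefectᴱ ζₑ aₑ bₑ cₑ fᴱ)
      scaled : Fin 7 → Expr 11
      scaled i = powE (q₄ᴱ ζₑ aₑ bₑ cₑ) 2 ⊗ (var (4 ↑ʳ i) ⊖ lookup (explicitSexticᴱ aₑ bₑ cₑ) i)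
      determined : (i : Fin 7) → T (isZero (reduce (norm (defect (toℕ i) ⊖ scaled i)))) →
        eval (ζ ∷ ρ) (defect (toℕ i)) ≈ 0# →
        lookup f i ≈ eval (ζ ∷ ρ) (lookup (explicitSexticᴱ aₑ bₑ cₑ) i)
      determined i identity defectᵢ≈0 = x∙y⁻¹≈ε⇒x≈y _ _
        (x≉0∧xy≈0⇒y≈0 (pow≉0 q₄≉0 2)
          (trans (sym (prove-cyclotomic ρ (defect (toℕ i)) (scaled i) identity)) defectᵢ≈0))

    -- f and g are split into their coefficients so that fromVec and Transform compute.
    transformed : ∀ {a b c} (f g : Vec Carrier 7) →
      Pointwise _≈_ f (map (eval (ζ ∷ a ∷ b ∷ c ∷ [])) (explicitSexticᴱ aₑ bₑ cₑ)) →
      Pointwise _≈_ g (map (eval (ζ ∷ a ∷ ζ * b ∷ c ∷ [])) (explicitSexticᴱ aₑ bₑ cₑ)) →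
      fromVec g ≈ₚ (cst (1# * 1#) *ₚ Transform f 1# 0# ((1# - ζ) * b * (a - c)) 1#)
    transformed {a} {b} {c} f@(_ ∷ _ ∷ _ ∷ _ ∷ _ ∷ _ ∷ _ ∷ []) g@(_ ∷ _ ∷ _ ∷ _ ∷ _ ∷ _ ∷ _ ∷ [])
      f≈F g≈G =
      vanishes 0 tt ∷ vanishes 1 tt ∷ vanishes 2 tt ∷ vanishes 3 tt ∷
      vanishes 4 tt ∷ vanishes 5 tt ∷ vanishes 6 tt ∷ []
      where
      ρ₀ : Vec Carrier 4
      ρ₀ = ζ ∷ a ∷ b ∷ c ∷ []
      ρ : Vec Carrier 18
      ρ = ζ ∷ a ∷ b ∷ c ∷ f ++ g
      ρ≈ : Pointwise _≈_ ρ (map (eval ρ₀) explicitSexticsᴱ)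
      ρ≈ = refl ∷ refl ∷ refl ∷ refl ∷ Pointwise.++⁺ f≈F g≈G
      difference : ℕ → Expr 18
      difference = coefficient differenceᴱ
      vanishes : ∀ i → T (isZero (reduce (norm (difference i [ explicitSexticsᴱ ] ⊖ zer)))) →
        eval ρ (difference i) ≈ 0#
      vanishes i identity = begin
        eval ρ (difference i)                           ≈⟨ eval-cong ρ≈ (difference i) ⟩
        eval (map (eval ρ₀) explicitSexticsᴱ) (difference i) ≡⟨ ≡.sym (eval-[] ρ₀ explicitSexticsᴱ (difference i)) ⟩
        eval ρ₀ (difference i [ explicitSexticsᴱ ])
          ≈⟨ prove-cyclotomic (a ∷ b ∷ c ∷ []) (difference i [ explicitSexticsᴱ ]) zer identity ⟩
        0#                                              ∎

proposition3p3 : ∀ {c ℓ} (k : CommutativeRing c ℓ) → IsField k →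
    let open Curves k in
    ¬ (lit 2 ≈ 0#) → ¬ (lit 3 ≈ 0#) →
    (ζ : Carrier) → pow ζ 3 ≈ 1# → ¬ (ζ ≈ 1#) →
    (a b c : Carrier) → ¬ (Δ ζ a b c ≈ 0#) →
    (f g : Vec Carrier 7) → IsSexticOf ζ a b c f → IsSexticOf ζ a (ζ * b) c g →
    CurveIso f g
proposition3p3 k isField _ _ ζ ζ³≈1 ζ≉1 a b c Δ≉0 f g f-sextic g-sextic =
  1# , 0# , (1# - ζ) * b * (a - c) , 1# , 1# , det≉0 _ , 1≉0 ,
  transformed ζ-root f g (sextic-determined ζ-root (Δ≉0⇒q₄≉0 Δ≉0) f f-sextic)
                         (sextic-determined ζ-root (Δ≉0⇒q₄[ζb]≉0 Δ≉0) g g-sextic)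
  where
  open Curves k
  open Isomorphism k isField
  ζ-root : ζ * ζ + ζ + 1# ≈ 0#
  ζ-root = primitive-cube-root ζ³≈1 ζ≉1
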